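{- Let $\mathbf{m}$ be the Thue–Morse word. If $k\ge 1$ and $2^{k-1}<n\le 2^k$, then $\operatorname{nsc}_{\mathbf{m}}(n)=3\cdot 2^{k-1}$.
   Context: The Thue–Morse word is $\mathbf{m}=\mu^{\omega}(0)=0110100110010110\cdots$, the fixed point starting with $0$ of the morphism $\mu(0)=01$, $\mu(1)=10$. For an infinite word $\mathbf{x}=x_0x_1x_2\cdots$ (indexed from $0$) and $n\ge1$, $\operatorname{nsc}_{\mathbf{x}}(n)=\max\{m\in\mathbb{N}: x_i\cdots x_{i+n-1}\neq x_j\cdots x_{j+n-1}\text{ for all } 0\le i<j\le m-1\}$. -}

module Defs where

open import Data.Nat using (ℕ; zero; suc; _+_; _<_; _≤_)
open import Data.Bool using (Bool; true; false)
open import Data.List using (List; []; _∷_; _++_; concatMap)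
open import Relation.Binary.PropositionalEquality using (_≡_)
open import Relation.Nullary using (¬_)

-- Letters 0 and 1 are encoded as false and true.
-- The Thue–Morse morphism μ(0) = 01, μ(1) = 10.
μ : Bool → List Bool
μ false = false ∷ true ∷ []
μ true  = true ∷ false ∷ []

μ* : List Bool → List Bool
μ* = concatMap μ

μpow : ℕ → List Bool
μpow zero    = false ∷ []
μpow (suc k) = μ* (μpow k)

-- i-th letter of a list (default false when out of range; never used out of range below)
at : List Bool → ℕ → Bool
at []       _       = false
at (x ∷ xs) zero    = x
at (x ∷ xs) (suc i) = at xs i

-- The Thue–Morse word m = μ^ω(0): letter i is the i-th letter of μ^(i+1)(0),
-- which has length 2^(i+1) > i (and each μ^k(0) is a prefix of μ^(k+1)(0)).
thueMorse : ℕ → Bool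
thueMorse i = at (μpow (suc i)) i

Word : Set
Word = ℕ → Bool

SameFactor : Word → ℕ → ℕ → ℕ → Set
SameFactor x n i j = ∀ t → t < n → x (i + t) ≡ x (j + t)

DistinctPrefixFactors : Word → ℕ → ℕ → Set
DistinctPrefixFactors x n M = ∀ i j → i < j → j < M → ¬ SameFactor x n i j

IsNsc : Word → ℕ → ℕ → Set
IsNsc x n M = DistinctPrefixFactors x n M × (∀ M' → DistinctPrefixFactors x n M' → M' ≤ M)
  where open import Data.Product using (_×_)

module Submission where

-- Upper bound: the prefix of length 2^(k+1) of m recurs at position 3·2^k (prefix-recurs), so the
-- factors of length n at positions 0 and 3·2^k coincide.  This follows by induction on k from
-- m(3)m(4) = m(0)m(1), because μ doubles equalities of factors (sameFactor-double).
--
-- Lower bound: the factors of length 2^k + 1 at positions 0, …, 3·2^k - 1 are pairwise distinct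
-- (distinct-prefix), hence so are the longer factors of length n.  The cases k = 0, 1 are decided
-- by evaluation.  In the inductive step, two equal factors of length 2L + 1 ≥ 5 at positions of
-- equal parity are μ-images of equal factors of length L + 1 at half the positions
-- (sameFactor-halve-even/odd), while positions of different parity would yield a factor ababa
-- (parity-clash), impossible because m contains no cube aaa.

open import Defs
open import Data.Nat using (ℕ; zero; suc; _+_; _*_; _^_; _<_; _≤_; z≤n; s≤s)
open import Data.Nat.Properties
open import Data.Nat.Tactic.RingSolver using (solve-∀)
open import Data.Bool using (false; true; not)
open import Data.Bool.Properties using (not-¬; ¬-not; not-injective) renaming (_≟_ to _≟ᵇ_)
open import Data.List using ([]; _∷_; _++_; length)
open import Data.List.Properties using (concatMap-++; length-++)
open import Data.Product using (∃; _,_)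
open import Data.Sum using (inj₁; inj₂)
open import Data.Unit using (tt)
open import Data.Empty using (⊥)
open import Relation.Nullary using (Dec; ¬?)
open import Relation.Nullary.Decidable using (map′; toWitness)
open import Relation.Binary.PropositionalEquality

data Parity : ℕ → Set where
  even : ∀ m → Parity (m + m)
  odd  : ∀ m → Parity (suc (m + m))

parity : ∀ n → Parity n
parity zero = even 0
parity (suc n) with parity n
... | even m = odd m
... | odd m  = subst Parity (cong suc (+-suc m m)) (even (suc m))

2^suc : ∀ k → 2 ^ suc k ≡ 2 ^ k + 2 ^ k
2^suc k = cong (2 ^ k +_) (+-identityʳ (2 ^ k))

n<2^n : ∀ n → n < 2 ^ n
n<2^n zero    = s≤s z≤n
n<2^n (suc n) = subst (suc n <_) (sym (2^suc n)) (+-mono-≤ (m^n>0 2 n) (n<2^n n))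

double-< : ∀ {m n} → m < n → suc (m + m) < n + n
double-< m<n = +-mono-≤-< m<n m<n

half-< : ∀ {m n} → m + m < n + n → m < n
half-< m+m<n+n = ≰⇒> (λ n≤m → <⇒≱ m+m<n+n (+-mono-≤ n≤m n≤m))

twice-+ : ∀ a s → (a + a) + (s + s) ≡ (a + s) + (a + s)
twice-+ = solve-∀

twice-+-suc : ∀ a s → (a + a) + suc (s + s) ≡ suc ((a + s) + (a + s))
twice-+-suc = solve-∀

twice-suc-+ : ∀ a s → suc (a + a) + suc (s + s) ≡ suc (a + s) + suc (a + s)
twice-suc-+ = solve-∀

triple-double : ∀ p → 3 * (2 * p) ≡ 3 * p + 3 * p
triple-double = solve-∀

sameFactor-mono : ∀ {m n} x i j → m ≤ n → SameFactor x n i j → SameFactor x m i j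
sameFactor-mono x i j m≤n same s s<m = same s (<-≤-trans s<m m≤n)

sameFactor-sym : ∀ {n} x i j → SameFactor x n i j → SameFactor x n j i
sameFactor-sym x i j same s s<n = sym (same s s<n)

ChangeAt : Word → ℕ → Set
ChangeAt x p = x p ≢ x (suc p)

change-transport : ∀ {x n i j s} → SameFactor x n i j → suc s < n →
                   ChangeAt x (j + s) → ChangeAt x (i + s)
change-transport {x} {_} {i} {j} {s} same s+1<n change eq = change (begin
  x (j + s)         ≡⟨ sym (same s (<-trans (n<1+n s) s+1<n)) ⟩
  x (i + s)         ≡⟨ eq ⟩
  x (suc (i + s))   ≡⟨ cong x (sym (+-suc i s)) ⟩
  x (i + suc s)     ≡⟨ same (suc s) s+1<n ⟩
  x (j + suc s)     ≡⟨ cong x (+-suc j s) ⟩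
  x (suc (j + s))   ∎)
  where open ≡-Reasoning

-- Agreement of two factors, and distinctness of the first M factors, are decidable; this settles
-- the smallest cases by evaluation.
sameFactor? : ∀ x n i j → Dec (SameFactor x n i j)
sameFactor? x n i j = map′ (λ agree s s<n → agree s<n) (λ same {s} s<n → same s s<n)
  (allUpTo? (λ s → x (i + s) ≟ᵇ x (j + s)) n)

distinctPrefixFactors? : ∀ x n M → Dec (DistinctPrefixFactors x n M)
distinctPrefixFactors? x n M =
  map′ (λ fresh i j i<j j<M → fresh j<M i<j) (λ distinct {j} j<M {i} i<j → distinct i j i<j j<M)
    (allUpTo? (λ j → allUpTo? (λ i → ¬? (sameFactor? x n i j)) j) M)

at-μ*-even : ∀ xs m → at (μ* xs) (m + m) ≡ at xs m
at-μ*-even []           m       = refl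
at-μ*-even (false ∷ xs) zero    = refl
at-μ*-even (true ∷ xs)  zero    = refl
at-μ*-even (false ∷ xs) (suc m) rewrite +-suc m m = at-μ*-even xs m
at-μ*-even (true ∷ xs)  (suc m) rewrite +-suc m m = at-μ*-even xs m

at-μ*-odd : ∀ xs m → m < length xs → at (μ* xs) (suc (m + m)) ≡ not (at xs m)
at-μ*-odd (false ∷ xs) zero    _       = refl
at-μ*-odd (true ∷ xs)  zero    _       = refl
at-μ*-odd (false ∷ xs) (suc m) (s≤s p) rewrite +-suc m m = at-μ*-odd xs m p
at-μ*-odd (true ∷ xs)  (suc m) (s≤s p) rewrite +-suc m m = at-μ*-odd xs m p

length-μ : ∀ x → length (μ x) ≡ 2
length-μ false = refl
length-μ true  = refl

length-μ* : ∀ xs → length (μ* xs) ≡ length xs + length xs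
length-μ* []       = refl
length-μ* (x ∷ xs) = begin
  length (μ x ++ μ* xs)               ≡⟨ length-++ (μ x) ⟩
  length (μ x) + length (μ* xs)       ≡⟨ cong₂ _+_ (length-μ x) (length-μ* xs) ⟩
  suc (suc (length xs + length xs))   ≡⟨ cong suc (sym (+-suc (length xs) (length xs))) ⟩
  length (x ∷ xs) + length (x ∷ xs)   ∎
  where open ≡-Reasoning

length-μpow : ∀ k → length (μpow k) ≡ 2 ^ k
length-μpow zero    = refl
length-μpow (suc k) = begin
  length (μ* (μpow k))                 ≡⟨ length-μ* (μpow k) ⟩
  length (μpow k) + length (μpow k)    ≡⟨ cong₂ _+_ (length-μpow k) (length-μpow k) ⟩
  2 ^ k + 2 ^ k                        ≡⟨ sym (2^suc k) ⟩
  2 ^ suc k                            ∎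
  where open ≡-Reasoning

at-++ : ∀ xs ys i → i < length xs → at (xs ++ ys) i ≡ at xs i
at-++ (x ∷ xs) ys zero    _       = refl
at-++ (x ∷ xs) ys (suc i) (s≤s p) = at-++ xs ys i p

-- μ^k(0) is a prefix of μ^l(0) for k ≤ l: μ preserves prefixes and μ^0(0) = 0 is a prefix of μ(0) = 01.
μpow-prefix : ∀ {k l} → k ≤ l → ∃ λ zs → μpow l ≡ μpow k ++ zs
μpow-prefix {zero}  {zero}  z≤n = [] , refl
μpow-prefix {zero}  {suc l} z≤n with μpow-prefix {zero} {l} z≤n
... | zs , eq = true ∷ μ* zs , cong μ* eq
μpow-prefix {suc k} {suc l} (s≤s k≤l) with μpow-prefix k≤l
... | zs , eq = μ* zs , trans (cong μ* eq) (concatMap-++ μ (μpow k) zs)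

at-μpow-mono : ∀ {k l i} → k ≤ l → i < 2 ^ k → at (μpow k) i ≡ at (μpow l) i
at-μpow-mono {k} {l} {i} k≤l i<2^k with μpow-prefix k≤l
... | zs , eq = begin
  at (μpow k) i          ≡⟨ sym (at-++ (μpow k) zs i (subst (i <_) (sym (length-μpow k)) i<2^k)) ⟩
  at (μpow k ++ zs) i    ≡⟨ cong (λ w → at w i) (sym eq) ⟩
  at (μpow l) i          ∎
  where open ≡-Reasoning

at-μpow : ∀ k i → i < 2 ^ k → at (μpow k) i ≡ thueMorse i
at-μpow k i i<2^k with ≤-total k (suc i)
... | inj₁ k≤1+i = at-μpow-mono k≤1+i i<2^k
... | inj₂ 1+i≤k = sym (at-μpow-mono 1+i≤k (<-≤-trans (n<2^n i) (^-monoʳ-≤ 2 (n≤1+n i))))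

tm : Word
tm = thueMorse

tm-even : ∀ i → tm (i + i) ≡ tm i
tm-even i = begin
  tm (i + i)                 ≡⟨ sym (at-μpow (suc i) (i + i) 2i<2^[1+i]) ⟩
  at (μ* (μpow i)) (i + i)   ≡⟨ at-μ*-even (μpow i) i ⟩
  at (μpow i) i              ≡⟨ at-μpow i i (n<2^n i) ⟩
  tm i                       ∎
  where
  open ≡-Reasoning
  2i<2^[1+i] : i + i < 2 ^ suc i
  2i<2^[1+i] = subst (i + i <_) (sym (2^suc i)) (<-trans (n<1+n (i + i)) (double-< (n<2^n i)))

tm-odd : ∀ i → tm (suc (i + i)) ≡ not (tm i)
tm-odd i = begin
  tm (suc (i + i))                 ≡⟨ sym (at-μpow (suc i) (suc (i + i)) 2i+1<2^[1+i]) ⟩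
  at (μ* (μpow i)) (suc (i + i))   ≡⟨ at-μ*-odd (μpow i) i (subst (i <_) (sym (length-μpow i)) (n<2^n i)) ⟩
  not (at (μpow i) i)              ≡⟨ cong not (at-μpow i i (n<2^n i)) ⟩
  not (tm i)                       ∎
  where
  open ≡-Reasoning
  2i+1<2^[1+i] : suc (i + i) < 2 ^ suc i
  2i+1<2^[1+i] = subst (suc (i + i) <_) (sym (2^suc i)) (double-< (n<2^n i))

-- The two letters of each block μ(a) differ: m changes at every even position.
change-even : ∀ m → ChangeAt tm (m + m)
change-even m eq = not-¬ refl (begin
  tm m               ≡⟨ sym (tm-even m) ⟩
  tm (m + m)         ≡⟨ eq ⟩
  tm (suc (m + m))   ≡⟨ tm-odd m ⟩
  not (tm m)         ∎)
  where open ≡-Reasoning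

-- A change at the odd position 2c+1 separates μ(m(c)) from μ(m(c+1)), so it forces m(c) = m(c+1).
change-odd⇒equal : ∀ c → ChangeAt tm (suc (c + c)) → tm c ≡ tm (suc c)
change-odd⇒equal c change = not-injective (¬-not (λ eq → change (begin
  tm (suc (c + c))       ≡⟨ tm-odd c ⟩
  not (tm c)             ≡⟨ eq ⟩
  tm (suc c)             ≡⟨ sym (tm-even (suc c)) ⟩
  tm (suc c + suc c)     ≡⟨ cong tm (+-suc (suc c) c) ⟩
  tm (suc (suc (c + c))) ∎)))
  where open ≡-Reasoning

-- m has no factor aaa: among c, c+1, c+2 some pair is an aligned block 2e, 2e+1.
no-cube : ∀ c → tm c ≡ tm (suc c) → tm (suc c) ≡ tm (suc (suc c)) → ⊥
no-cube c eq₁ eq₂ with parity c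
... | even e = change-even e eq₁
... | odd e  = change-even (suc e) (subst₂ (λ p q → tm p ≡ tm q) next-block (cong suc next-block) eq₂)
  where
  next-block : suc (suc (e + e)) ≡ suc e + suc e
  next-block = cong suc (sym (+-suc e e))

-- Changes at two consecutive odd positions 2c+1, 2c+3 would produce the cube m(c)m(c+1)m(c+2).
no-odd-changes : ∀ c → ChangeAt tm (suc (c + c)) → ChangeAt tm (suc (suc c + suc c)) → ⊥
no-odd-changes c ch ch′ = no-cube c (change-odd⇒equal c ch) (change-odd⇒equal (suc c) ch′)

-- m has no factor ababa, since such a factor changes at two consecutive odd positions.
no-alternation : ∀ x → ChangeAt tm (x + 0) → ChangeAt tm (x + 1) →
                 ChangeAt tm (x + 2) → ChangeAt tm (x + 3) → ⊥
no-alternation x ch₀ ch₁ ch₂ ch₃ with parity x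
... | even c = no-odd-changes c (subst (ChangeAt tm) (even-1 c) ch₁) (subst (ChangeAt tm) (even-3 c) ch₃)
  where
  even-1 : ∀ c → c + c + 1 ≡ suc (c + c)
  even-1 = solve-∀
  even-3 : ∀ c → c + c + 3 ≡ suc (suc c + suc c)
  even-3 = solve-∀
... | odd c  = no-odd-changes c (subst (ChangeAt tm) (odd-0 c) ch₀) (subst (ChangeAt tm) (odd-2 c) ch₂)
  where
  odd-0 : ∀ c → suc (c + c) + 0 ≡ suc (c + c)
  odd-0 = solve-∀
  odd-2 : ∀ c → suc (c + c) + 2 ≡ suc (suc c + suc c)
  odd-2 = solve-∀

change-from-even : ∀ a s → ChangeAt tm ((a + a) + (s + s))
change-from-even a s = subst (ChangeAt tm) (sym (twice-+ a s)) (change-even (a + s))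

change-from-odd : ∀ b s → ChangeAt tm (suc (b + b) + suc (s + s))
change-from-odd b s = subst (ChangeAt tm) (sym (twice-suc-+ b s)) (change-even (suc (b + s)))

-- A factor of length 5 never occurs at both an even and an odd position: it would change letter at
-- offsets 0, 2 (from the even occurrence) and at offsets 1, 3 (from the odd one), i.e. be ababa.
parity-clash : ∀ a b → SameFactor tm 5 (a + a) (suc (b + b)) → ⊥
parity-clash a b same = no-alternation (a + a)
  (change-from-even a 0)
  (from-odd 1 (s≤s (s≤s (s≤s z≤n))) (change-from-odd b 0))
  (change-from-even a 1)
  (from-odd 3 (s≤s (s≤s (s≤s (s≤s (s≤s z≤n))))) (change-from-odd b 1))
  where
  from-odd : ∀ s → suc s < 5 → ChangeAt tm (suc (b + b) + s) → ChangeAt tm ((a + a) + s)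
  from-odd s = change-transport {tm} {5} {a + a} {suc (b + b)} {s} same

-- Since m is a fixed point of μ, equal factors of length L at i and j have equal images of
-- length 2L at 2i and 2j.
sameFactor-double : ∀ L i j → SameFactor tm L i j → SameFactor tm (L + L) (i + i) (j + j)
sameFactor-double L i j same s s<2L with parity s
... | even u = begin
  tm ((i + i) + (u + u))   ≡⟨ cong tm (twice-+ i u) ⟩
  tm ((i + u) + (i + u))   ≡⟨ tm-even (i + u) ⟩
  tm (i + u)               ≡⟨ same u (half-< s<2L) ⟩
  tm (j + u)               ≡⟨ sym (tm-even (j + u)) ⟩
  tm ((j + u) + (j + u))   ≡⟨ cong tm (sym (twice-+ j u)) ⟩
  tm ((j + j) + (u + u))   ∎
  where open ≡-Reasoning
... | odd u = begin
  tm ((i + i) + suc (u + u))   ≡⟨ cong tm (twice-+-suc i u) ⟩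
  tm (suc ((i + u) + (i + u))) ≡⟨ tm-odd (i + u) ⟩
  not (tm (i + u))             ≡⟨ cong not (same u (half-< (<-trans (n<1+n (u + u)) s<2L))) ⟩
  not (tm (j + u))             ≡⟨ sym (tm-odd (j + u)) ⟩
  tm (suc ((j + u) + (j + u))) ≡⟨ cong tm (sym (twice-+-suc j u)) ⟩
  tm ((j + j) + suc (u + u))   ∎
  where open ≡-Reasoning

sameFactor-halve-even : ∀ L a b → SameFactor tm (suc (L + L)) (a + a) (b + b) →
                        SameFactor tm (suc L) a b
sameFactor-halve-even L a b same u (s≤s u≤L) = begin
  tm (a + u)               ≡⟨ sym (tm-even (a + u)) ⟩
  tm ((a + u) + (a + u))   ≡⟨ cong tm (sym (twice-+ a u)) ⟩
  tm ((a + a) + (u + u))   ≡⟨ same (u + u) (s≤s (+-mono-≤ u≤L u≤L)) ⟩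
  tm ((b + b) + (u + u))   ≡⟨ cong tm (twice-+ b u) ⟩
  tm ((b + u) + (b + u))   ≡⟨ tm-even (b + u) ⟩
  tm (b + u)               ∎
  where open ≡-Reasoning

sameFactor-halve-odd : ∀ L a b → SameFactor tm (suc (L + L)) (suc (a + a)) (suc (b + b)) →
                       SameFactor tm (suc L) a b
sameFactor-halve-odd L a b same zero _ = begin
  tm (a + 0)    ≡⟨ cong tm (+-identityʳ a) ⟩
  tm a          ≡⟨ not-injective (begin
    not (tm a)                  ≡⟨ sym (tm-odd a) ⟩
    tm (suc (a + a))            ≡⟨ cong tm (sym (+-identityʳ (suc (a + a)))) ⟩
    tm (suc (a + a) + 0)        ≡⟨ same 0 (s≤s z≤n) ⟩
    tm (suc (b + b) + 0)        ≡⟨ cong tm (+-identityʳ (suc (b + b))) ⟩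
    tm (suc (b + b))            ≡⟨ tm-odd b ⟩
    not (tm b)                  ∎) ⟩
  tm b          ≡⟨ cong tm (sym (+-identityʳ b)) ⟩
  tm (b + 0)    ∎
  where open ≡-Reasoning
sameFactor-halve-odd L a b same (suc u) (s≤s u<L) = begin
  tm (a + suc u)                     ≡⟨ cong tm (+-suc a u) ⟩
  tm (suc (a + u))                   ≡⟨ sym (tm-even (suc (a + u))) ⟩
  tm (suc (a + u) + suc (a + u))     ≡⟨ cong tm (sym (twice-suc-+ a u)) ⟩
  tm (suc (a + a) + suc (u + u))     ≡⟨ same (suc (u + u)) (s≤s (<⇒≤ (double-< u<L))) ⟩
  tm (suc (b + b) + suc (u + u))     ≡⟨ cong tm (twice-suc-+ b u) ⟩
  tm (suc (b + u) + suc (b + u))     ≡⟨ tm-even (suc (b + u)) ⟩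
  tm (suc (b + u))                   ≡⟨ cong tm (sym (+-suc b u)) ⟩
  tm (b + suc u)                     ∎
  where open ≡-Reasoning

-- Two occurrences at positions of equal parity halve to occurrences of a
-- factor of length L+1; positions of different parity are excluded by parity-clash.
distinct-double : ∀ {L M} → 2 ≤ L → DistinctPrefixFactors tm (suc L) M →
                  DistinctPrefixFactors tm (suc (L + L)) (M + M)
distinct-double {L} 2≤L distinct i j i<j j<2M same with parity i | parity j
... | even a | even b = distinct a b (half-< i<j) (half-< j<2M) (sameFactor-halve-even L a b same)
... | odd a  | odd b  = distinct a b (half-< (≤-pred i<j)) (half-< (<-trans (n<1+n (b + b)) j<2M))
                          (sameFactor-halve-odd L a b same)
... | even a | odd b  = parity-clash a b (sameFactor-mono tm (a + a) (suc (b + b)) (s≤s (+-mono-≤ 2≤L 2≤L)) same)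
... | odd a  | even b = parity-clash b a
  (sameFactor-mono tm (b + b) (suc (a + a)) (s≤s (+-mono-≤ 2≤L 2≤L)) (sameFactor-sym tm (suc (a + a)) (b + b) same))

distinct-prefix : ∀ k → DistinctPrefixFactors tm (suc (2 ^ k)) (3 * 2 ^ k)
distinct-prefix zero          = toWitness {a? = distinctPrefixFactors? tm 2 3} tt
distinct-prefix (suc zero)    = toWitness {a? = distinctPrefixFactors? tm 3 6} tt
distinct-prefix (suc (suc k)) =
  subst₂ (DistinctPrefixFactors tm) (cong suc (sym (2^suc (suc k)))) (sym (triple-double P))
    (distinct-double {P} {3 * P} (^-monoʳ-≤ 2 {1} {suc k} (s≤s z≤n)) (distinct-prefix (suc k)))
  where
  P : ℕ
  P = 2 ^ suc k

prefix-recurs : ∀ k → SameFactor tm (2 ^ suc k) 0 (3 * 2 ^ k)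
prefix-recurs zero    = toWitness {a? = sameFactor? tm 2 0 3} tt
prefix-recurs (suc k) =
  subst₂ (λ n j → SameFactor tm n 0 j) (sym (2^suc (suc k))) (sym (triple-double (2 ^ k)))
    (sameFactor-double (2 ^ suc k) 0 (3 * 2 ^ k) (prefix-recurs k))

mainTheorem2 : ∀ (k n : ℕ) → 2 ^ k < n → n ≤ 2 ^ suc k →
    IsNsc thueMorse n (3 * 2 ^ k)
mainTheorem2 k n 2^k<n n≤2^[k+1] = distinct , maximal
  where
  distinct : DistinctPrefixFactors tm n (3 * 2 ^ k)
  distinct i j i<j j<M same = distinct-prefix k i j i<j j<M (sameFactor-mono tm i j 2^k<n same)
  -- Positions 0 and 3·2^k carry the same factor of length n, so no larger M works.
  maximal : ∀ M → DistinctPrefixFactors tm n M → M ≤ 3 * 2 ^ k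
  maximal M distinct′ = ≮⇒≥ (λ 3·2^k<M →
    distinct′ 0 (3 * 2 ^ k) 0<3·2^k 3·2^k<M
      (sameFactor-mono tm 0 (3 * 2 ^ k) n≤2^[k+1] (prefix-recurs k)))
    where
    0<3·2^k : 0 < 3 * 2 ^ k
    0<3·2^k = <-≤-trans (m^n>0 2 k) (m≤m+n (2 ^ k) (2 * 2 ^ k))
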